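{- Let $n$ be a positive integer. Then: (1) $K_{n+1}\oplus_{=}\overline{K_{n+1}}$ contains a vertex-minor isomorphic to $T_{2,n}$; (2) $K_{n+2}\oplus_{=}K_{n+2}$ contains a vertex-minor isomorphic to $T_{2,n}$; (3) $K_{n+2}\oplus_{\neq}\overline{K_{n+2}}$ contains a vertex-minor isomorphic to $T_{2,n}$; (4) $K_{n+1}\oplus_{\neq}K_{n+1}$ contains a vertex-minor isomorphic to $T_{2,n}$. Therefore, if $A=\begin{pmatrix}0&0\\0&0\end{pmatrix}$, then all of $(K_{n+1}\oplus_{=} \overline{K_{n+1}})^n_A$, $(K_{n+2}\oplus_{=} K_{n+2})^n_A$, $(K_{n+2}\oplus_{\neq} \overline{K_{n+2}})^n_A$, and $(K_{n+1}\oplus_{\neq} K_{n+1})^n_A$ have vertex-minors isomorphic to $nT_{2,n}$.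
   Context: $\overline{K_m}$ is the edgeless graph on $m$ vertices; $T_{2,n}$ is the $1$-subdivision of the star $K_{1,n}$; $nH$ is the disjoint union of $n$ copies of $H$. For two $m$-vertex graphs $G,H$ on disjoint vertex sets with orderings $v_1,\dots,v_m$ and $w_1,\dots,w_m$, $G\oplus_{=}H$ (resp. $G\oplus_{\neq}H$) is the graph on $V(G)\cup V(H)$ inducing $G$ on $V(G)$ and $H$ on $V(H)$, in which $v_iw_j$ is an edge iff $i=j$ (resp. iff $i\neq j$). For $\odot\in\{\oplus_=,\oplus_{\neq}\}$, a positive integer $s$ and a $0$-$1$ matrix $A=\begin{pmatrix}a&b\\c&d\end{pmatrix}$, $(G\odot H)^s_A$ is the disjoint union of $s$ copies of $G\odot H$ with added edges such that for all $1\le i<j\le s$, the $i$-th copy of $G$ is complete (if $a=1$) or anti-complete (if $a=0$) to the $j$-th copy of $G$; likewise with $b$ for ($i$-th $G$, $j$-th $H$), $c$ for ($i$-th $H$, $j$-th $G$), and $d$ for ($i$-th $H$, $j$-th $H$). Local complementation at $v$ replaces the subgraph induced on $N_G(v)$ by its complement; a vertex-minor of $G$ is an induced subgraph of a graph obtained from $G$ by a sequence of local complementations. -}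

module Defs where

open import Data.Nat using (ℕ; suc)
open import Data.Bool using (Bool; true; false; _∧_; _xor_; not; if_then_else_)
open import Data.Bool.Properties using (∧-comm; ∧-zeroʳ) renaming (_≟_ to _≟B_)
open import Data.Fin using (Fin; _<_)
open import Data.Fin.Properties using (<-cmp) renaming (_≟_ to _≟F_)
open import Data.Product using (Σ; _×_; _,_; proj₁)
open import Data.Product.Properties using () renaming (≡-dec to ×-dec)
open import Data.Maybe using (Maybe; just; nothing)
open import Data.Empty using (⊥-elim)
open import Relation.Nullary using (yes; no; does)
open import Relation.Binary.PropositionalEquality using (_≡_; refl; sym; cong; cong₂)
open import Relation.Binary.Definitions using (DecidableEquality; Tri; tri<; tri≈; tri>)
open import Function.Definitions using (Injective)

record Graph (V : Set) : Set where
  field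
    adj     : V → V → Bool
    adj-sym : ∀ x y → adj x y ≡ adj y x
    adj-irr : ∀ x → adj x x ≡ false
open Graph public

module _ {V : Set} (_≟_ : DecidableEquality V) where

  eqB-sym : ∀ x y → does (x ≟ y) ≡ does (y ≟ x)
  eqB-sym x y with x ≟ y | y ≟ x
  ... | yes _ | yes _ = refl
  ... | no _  | no _  = refl
  ... | yes p | no q  = ⊥-elim (q (sym p))
  ... | no p  | yes q = ⊥-elim (p (sym q))

  eqB-refl : ∀ x → does (x ≟ x) ≡ true
  eqB-refl x with x ≟ x
  ... | yes _ = refl
  ... | no p  = ⊥-elim (p refl)

module VM {V : Set} (_≟_ : DecidableEquality V) where

  lcAdj : Graph V → V → V → V → Bool
  lcAdj G v x y = if does (x ≟ y) then false
                  else (adj G x y xor (adj G v x ∧ adj G v y))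

  lcIrr : ∀ G v x → lcAdj G v x x ≡ false
  lcIrr G v x with x ≟ x
  ... | yes _ = refl
  ... | no p  = ⊥-elim (p refl)

  localComp : Graph V → V → Graph V
  localComp G v = record
    { adj     = lcAdj G v
    ; adj-sym = λ x y → cong₂ (λ b c → if b then false else c)
                  (eqB-sym _≟_ x y)
                  (cong₂ _xor_ (adj-sym G x y) (∧-comm (adj G v x) (adj G v y)))
    ; adj-irr = lcIrr G v
    }

  data _⟶*_ : Graph V → Graph V → Set where
    done : ∀ {G} → G ⟶* G
    step : ∀ {G H} (v : V) → localComp G v ⟶* H → G ⟶* H

_↪_ : {W V : Set} → Graph W → Graph V → Set
_↪_ {W} {V} H G = Σ (W → V) λ f →
  Injective _≡_ _≡_ f × (∀ x y → adj H x y ≡ adj G (f x) (f y))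

HasVertexMinor : {V W : Set} → DecidableEquality V → Graph V → Graph W → Set
HasVertexMinor {V} _≟_ G H = Σ (Graph V) λ G' → (G ⟶* G') × (H ↪ G')
  where open VM _≟_

K : (m : ℕ) → Graph (Fin m)
K m = record
  { adj     = λ i j → not (does (i ≟F j))
  ; adj-sym = λ i j → cong not (eqB-sym _≟F_ i j)
  ; adj-irr = λ i → cong not (eqB-refl _≟F_ i)
  }

Kbar : (m : ℕ) → Graph (Fin m)
Kbar m = record { adj = λ _ _ → false ; adj-sym = λ _ _ → refl ; adj-irr = λ _ → refl }

-- gluing two graphs on Fin m; vertex (false , i) = v_i of G, (true , i) = w_i of H
glue : {m : ℕ} → (cross : Fin m → Fin m → Bool) → (∀ i j → cross i j ≡ cross j i) →
       Graph (Fin m) → Graph (Fin m) → Graph (Bool × Fin m)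
glue cross cs G H = record { adj = a ; adj-sym = s ; adj-irr = r }
  where
  a : _ → _ → Bool
  a (false , i) (false , j) = adj G i j
  a (true  , i) (true  , j) = adj H i j
  a (false , i) (true  , j) = cross i j
  a (true  , i) (false , j) = cross i j
  s : ∀ x y → a x y ≡ a y x
  s (false , i) (false , j) = adj-sym G i j
  s (true  , i) (true  , j) = adj-sym H i j
  s (false , i) (true  , j) = cs i j
  s (true  , i) (false , j) = cs i j
  r : ∀ x → a x x ≡ false
  r (false , i) = adj-irr G i
  r (true  , i) = adj-irr H i

_⊕₌_ : {m : ℕ} → Graph (Fin m) → Graph (Fin m) → Graph (Bool × Fin m)
_⊕₌_ = glue (λ i j → does (i ≟F j)) (eqB-sym _≟F_)

_⊕≠_ : {m : ℕ} → Graph (Fin m) → Graph (Fin m) → Graph (Bool × Fin m)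
_⊕≠_ = glue (λ i j → not (does (i ≟F j))) (λ i j → cong not (eqB-sym _≟F_ i j))

-- a 2x2 0-1 matrix, indexed by sides (false = G-side, true = H-side):
-- entry (false,false) = a, (false,true) = b, (true,false) = c, (true,true) = d
Mat2 : Set
Mat2 = Bool → Bool → Bool

zeroMat : Mat2
zeroMat _ _ = false

-- (P)^s_A for P = G ⊙ H on Bool × Fin m; vertex (k , x) = vertex x of the k-th copy.
-- For copies k < l, a vertex of side σ in copy k and side τ in copy l are adjacent iff A σ τ.
powAdj : {s m : ℕ} → Mat2 → Graph (Bool × Fin m) → {k l : Fin s} →
         Tri (k < l) (k ≡ l) (l < k) → Bool × Fin m → Bool × Fin m → Bool
powAdj A P (tri< _ _ _) x y = A (proj₁ x) (proj₁ y)
powAdj A P (tri≈ _ _ _) x y = adj P x y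
powAdj A P (tri> _ _ _) x y = A (proj₁ y) (proj₁ x)

pow : {m : ℕ} → (s : ℕ) → Mat2 → Graph (Bool × Fin m) → Graph (Fin s × (Bool × Fin m))
pow {m} s A P = record { adj = a ; adj-sym = sy ; adj-irr = ir }
  where
  a : Fin s × (Bool × Fin m) → Fin s × (Bool × Fin m) → Bool
  a (k , x) (l , y) = powAdj A P (<-cmp k l) x y
  sy : ∀ u v → a u v ≡ a v u
  sy (k , x) (l , y) with <-cmp k l | <-cmp l k
  ... | tri< _ _ _     | tri> _ _ _    = refl
  ... | tri> _ _ _     | tri< _ _ _    = refl
  ... | tri≈ _ _ _     | tri≈ _ _ _    = adj-sym P x y
  ... | tri< p _ _     | tri< _ _ q    = ⊥-elim (q p)
  ... | tri< _ q _     | tri≈ _ e _    = ⊥-elim (q (sym e))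
  ... | tri≈ _ _ q     | tri< p _ _    = ⊥-elim (q p)
  ... | tri≈ q _ _     | tri> _ _ p    = ⊥-elim (q p)
  ... | tri> _ q _     | tri≈ _ e _    = ⊥-elim (q (sym e))
  ... | tri> _ _ p     | tri> q _ _    = ⊥-elim (q p)
  ir : ∀ u → a u u ≡ false
  ir (k , x) with <-cmp k k
  ... | tri< _ q _ = ⊥-elim (q refl)
  ... | tri≈ _ _ _ = adj-irr P x
  ... | tri> _ q _ = ⊥-elim (q refl)

copies : {W : Set} → (n : ℕ) → Graph W → Graph (Fin n × W)
copies n H = record
  { adj     = λ { (i , x) (j , y) → does (i ≟F j) ∧ adj H x y }
  ; adj-sym = λ { (i , x) (j , y) → cong₂ _∧_ (eqB-sym _≟F_ i j) (adj-sym H x y) }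
  ; adj-irr = λ { (i , x) → irr i x }
  }
  where
  irr : ∀ i x → does (i ≟F i) ∧ adj H x x ≡ false
  irr i x rewrite adj-irr H x = ∧-zeroʳ _

-- T_{2,n}: 1-subdivision of the star K_{1,n}.
-- nothing = centre, just (false , i) = subdivision vertex i, just (true , i) = leaf i.
xor-self : ∀ b → b xor b ≡ false
xor-self false = refl
xor-self true  = refl

xor-comm : ∀ b c → b xor c ≡ c xor b
xor-comm false false = refl
xor-comm false true  = refl
xor-comm true  false = refl
xor-comm true  true  = refl

T2 : (n : ℕ) → Graph (Maybe (Bool × Fin n))
T2 n = record { adj = a ; adj-sym = sy ; adj-irr = ir }
  where
  a : Maybe (Bool × Fin n) → Maybe (Bool × Fin n) → Bool
  a nothing nothing                 = false
  a nothing (just (b , _))          = not b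
  a (just (b , _)) nothing          = not b
  a (just (b , i)) (just (c , j))   = (b xor c) ∧ does (i ≟F j)
  sy : ∀ x y → a x y ≡ a y x
  sy nothing nothing               = refl
  sy nothing (just _)              = refl
  sy (just _) nothing              = refl
  sy (just (b , i)) (just (c , j)) = cong₂ _∧_ (xor-comm b c) (eqB-sym _≟F_ i j)
  ir : ∀ x → a x x ≡ false
  ir nothing = refl
  ir (just (b , i)) rewrite xor-self b = refl

decGlue : {m : ℕ} → DecidableEquality (Bool × Fin m)
decGlue = ×-dec _≟B_ _≟F_

decPow : {s m : ℕ} → DecidableEquality (Fin s × (Bool × Fin m))
decPow = ×-dec _≟F_ decGlue

module Submission where

-- (a) Parity sums ⨁ over Fin n, and the effect of local complementation at a
--     family of pairwise non-adjacent vertices: the pair xy toggles exactly when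
--     an odd number of those vertices are common neighbours of x and y.
-- (b) T_{2,n} is a spider: a centre joined to n "middle" vertices, each with a
--     pendant "foot".  In a glued graph on Bool × Fin m, a spider with centre c
--     and legs (false , σ i) - (true , σ i) yields an induced copy of T_{2,n}.
-- (c) The four parts of the first claim: one or two local complementations
--     (parts 1-3), resp. one followed by n at an independent set (part 4),
--     leave a spider in the glued graph.
-- (d) (P)^n_A with A = 0 is, adjacency-wise, the disjoint union nP.  The n
--     copies of a vertex u are independent in nP, so by (a) complementing at
--     all of them complements every copy of P at u.  Hence a witness for T_{2,n}
--     in P lifts to one for nT_{2,n} in (P)^n_0, giving the second claim.

open import Defs
open import Data.Nat using (ℕ; zero; suc; _≤_)
open import Data.Bool using (Bool; true; false; _∧_; _xor_; if_then_else_)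
open import Data.Bool.Properties using (xor-identityʳ; xor-assoc; ∧-zeroʳ)
open import Data.Fin using (Fin; zero; suc)
open import Data.Fin.Properties using (suc-injective; <-cmp) renaming (_≟_ to _≟F_)
open import Data.List using (List; []; _∷_; _++_; tabulate; concatMap)
open import Data.Maybe using (Maybe; just; nothing)
open import Data.Product using (Σ; _×_; _,_; proj₂)
open import Data.Product.Properties using (≡-dec; ,-injectiveˡ; ,-injectiveʳ)
open import Data.Empty using (⊥-elim)
open import Relation.Nullary using (Dec; yes; no; does)
open import Relation.Nullary.Decidable using (dec-true; dec-false; does-⇔)
open import Function.Bundles using (mk⇔)
open import Relation.Binary.PropositionalEquality
  using (_≡_; _≢_; refl; sym; trans; cong; cong₂; module ≡-Reasoning)
open import Relation.Binary.Definitions using (DecidableEquality; tri<; tri≈; tri>)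
open import Function.Definitions using (Injective)

⨁ : ∀ {n} → (Fin n → Bool) → Bool
⨁ {zero}  h = false
⨁ {suc n} h = h zero xor ⨁ (λ j → h (suc j))

⨁-cong : ∀ {n} {h h' : Fin n → Bool} → (∀ j → h j ≡ h' j) → ⨁ h ≡ ⨁ h'
⨁-cong {zero}  e = refl
⨁-cong {suc n} e = cong₂ _xor_ (e zero) (⨁-cong (λ j → e (suc j)))

⨁-zero : ∀ {n} {h : Fin n → Bool} → (∀ j → h j ≡ false) → ⨁ h ≡ false
⨁-zero {zero}  e = refl
⨁-zero {suc n} e rewrite e zero = ⨁-zero (λ j → e (suc j))

⨁-single : ∀ {n} {h : Fin n → Bool} (i : Fin n) →
           (∀ j → j ≢ i → h j ≡ false) → ⨁ h ≡ h i
⨁-single {suc n} {h} zero e =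
  trans (cong (h zero xor_) (⨁-zero (λ j → e (suc j) λ ()))) (xor-identityʳ (h zero))
⨁-single {suc n} (suc i) e rewrite e zero (λ ()) =
  ⨁-single i (λ j j≢i → e (suc j) (λ sj≡si → j≢i (suc-injective sj≡si)))

-- Graphs with the same adjacency.  Graph records carry proofs, so this
-- pointwise relation is the right notion of equality between them.
_≐_ : {V : Set} → Graph V → Graph V → Set
G ≐ G' = ∀ x y → adj G x y ≡ adj G' x y

↪-resp : {V W : Set} {H : Graph W} {G G' : Graph V} → H ↪ G → G ≐ G' → H ↪ G'
↪-resp (f , f-inj , f-adj) G≐G' = f , f-inj , λ x y → trans (f-adj x y) (G≐G' (f x) (f y))

guard-xor : ∀ d a t u →
  (if d then false else ((if d then false else (a xor t)) xor u))
  ≡ (if d then false else (a xor (t xor u)))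
guard-xor true  a t u = refl
guard-xor false a t u = xor-assoc a t u

guard-false : ∀ d → (if d then false else false) ≡ false
guard-false true  = refl
guard-false false = refl

module LocalComplementation {V : Set} (_≟_ : DecidableEquality V) where
  open VM _≟_ public

  lcs : Graph V → List V → Graph V
  lcs G []      = G
  lcs G (v ∷ l) = lcs (localComp G v) l

  lcs-reaches : ∀ G l → G ⟶* lcs G l
  lcs-reaches G []      = done
  lcs-reaches G (v ∷ l) = step v (lcs-reaches (localComp G v) l)

  lcs-++ : ∀ G l l' → lcs G (l ++ l') ≡ lcs (lcs G l) l'
  lcs-++ G []      l' = refl
  lcs-++ G (v ∷ l) l' = lcs-++ (localComp G v) l l'

  localComp-resp : ∀ {G G'} → G ≐ G' → ∀ v → localComp G v ≐ localComp G' v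
  localComp-resp G≐G' v x y =
    cong₂ (λ a t → if does (x ≟ y) then false else (a xor t))
          (G≐G' x y) (cong₂ _∧_ (G≐G' v x) (G≐G' v y))

  lcs-resp : ∀ {G G'} → G ≐ G' → ∀ l → lcs G l ≐ lcs G' l
  lcs-resp G≐G' []      = G≐G'
  lcs-resp {G} {G'} G≐G' (v ∷ l) = lcs-resp (localComp-resp {G} {G'} G≐G' v) l

  vertexMinor : ∀ {W} {G : Graph V} {H : Graph W} (l : List V) →
                H ↪ lcs G l → HasVertexMinor _≟_ G H
  vertexMinor {G = G} l H↪ = lcs G l , lcs-reaches G l , H↪

  localComp-nonadj : ∀ G v u z → adj G v u ≡ false →
                     adj (localComp G v) u z ≡ adj G u z
  localComp-nonadj G v u z vu with u ≟ z
  ... | yes refl = sym (adj-irr G u)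
  ... | no _ rewrite vu = xor-identityʳ (adj G u z)

  localComp-independent :
    ∀ {n} G (f : Fin n → V) → (∀ a b → adj G (f a) (f b) ≡ false) → ∀ x y →
    adj (lcs G (tabulate f)) x y
    ≡ (if does (x ≟ y) then false
       else (adj G x y xor ⨁ (λ k → adj G (f k) x ∧ adj G (f k) y)))
  localComp-independent {zero} G f indep x y with x ≟ y
  ... | yes refl = adj-irr G x
  ... | no _     = sym (xor-identityʳ (adj G x y))
  localComp-independent {suc n} G f indep x y = begin
      adj (lcs G' (tabulate (λ k → f (suc k)))) x y
    ≡⟨ localComp-independent G' (λ k → f (suc k)) indep' x y ⟩
      (if does (x ≟ y) then false
       else (adj G' x y xor ⨁ (λ k → adj G' (f (suc k)) x ∧ adj G' (f (suc k)) y)))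
    ≡⟨ cong (λ t → if does (x ≟ y) then false else (adj G' x y xor t))
            (⨁-cong (λ k → cong₂ _∧_ (unchanged (suc k) x) (unchanged (suc k) y))) ⟩
      (if does (x ≟ y) then false
       else (adj G' x y xor ⨁ (λ k → adj G (f (suc k)) x ∧ adj G (f (suc k)) y)))
    ≡⟨ guard-xor (does (x ≟ y)) (adj G x y) (adj G (f zero) x ∧ adj G (f zero) y) _ ⟩
      (if does (x ≟ y) then false
       else (adj G x y xor ⨁ (λ k → adj G (f k) x ∧ adj G (f k) y)))
    ∎
    where
    open ≡-Reasoning
    G' : Graph V
    G' = localComp G (f zero)
    unchanged : ∀ k z → adj G' (f k) z ≡ adj G (f k) z
    unchanged k z = localComp-nonadj G (f zero) (f k) z (indep zero k)
    indep' : ∀ a b → adj G' (f (suc a)) (f (suc b)) ≡ false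
    indep' a b = trans (unchanged (suc a) (f (suc b))) (indep (suc a) (suc b))

record Spider {m n : ℕ} (G : Graph (Bool × Fin m))
              (c : Bool × Fin m) (σ : Fin n → Fin m) : Set where
  field
    centre-middle : ∀ j → adj G c (false , σ j) ≡ true
    centre-foot   : ∀ j → adj G c (true , σ j) ≡ false
    middle-middle : ∀ i j → adj G (false , σ i) (false , σ j) ≡ false
    middle-foot   : ∀ i j → adj G (false , σ i) (true , σ j) ≡ does (i ≟F j)
    foot-foot     : ∀ i j → adj G (true , σ i) (true , σ j) ≡ false

spider-↪ : ∀ {m n} {G : Graph (Bool × Fin m)} {c : Bool × Fin m} {σ : Fin n → Fin m} →
           Injective _≡_ _≡_ σ → (∀ i → proj₂ c ≢ σ i) → Spider G c σ → T2 n ↪ G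
spider-↪ {m} {n} {G} {c} {σ} σ-inj c∉σ S = emb , emb-inj , emb-adj
  where
  open Spider S
  emb : Maybe (Bool × Fin n) → Bool × Fin m
  emb nothing        = c
  emb (just (b , i)) = (b , σ i)

  emb-inj : Injective _≡_ _≡_ emb
  emb-inj {nothing}      {nothing}      _ = refl
  emb-inj {nothing}      {just (_ , i)} e = ⊥-elim (c∉σ i (cong proj₂ e))
  emb-inj {just (_ , i)} {nothing}      e = ⊥-elim (c∉σ i (cong proj₂ (sym e)))
  emb-inj {just _}       {just _}       e =
    cong₂ (λ b i → just (b , i)) (,-injectiveˡ e) (σ-inj (,-injectiveʳ e))

  flipped : ∀ {x y} → adj (T2 n) y x ≡ adj G (emb y) (emb x) →
            adj (T2 n) x y ≡ adj G (emb x) (emb y)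
  flipped {x} {y} e = trans (adj-sym (T2 n) x y) (trans e (adj-sym G (emb y) (emb x)))

  emb-adj : ∀ x y → adj (T2 n) x y ≡ adj G (emb x) (emb y)
  emb-adj nothing            nothing            = sym (adj-irr G c)
  emb-adj nothing            (just (false , j)) = sym (centre-middle j)
  emb-adj nothing            (just (true , j))  = sym (centre-foot j)
  emb-adj (just (false , i)) (just (false , j)) = sym (middle-middle i j)
  emb-adj (just (false , i)) (just (true , j))  = sym (middle-foot i j)
  emb-adj (just (true , i))  (just (true , j))  = sym (foot-foot i j)
  emb-adj (just (false , i)) nothing            = flipped (sym (centre-middle i))
  emb-adj (just (true , i))  nothing            = flipped (sym (centre-foot i))
  emb-adj (just (true , i))  (just (false , j)) = flipped (sym (middle-foot j i))

module GlueLC {m : ℕ} = LocalComplementation (decGlue {m})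
open GlueLC using (localComp; lcs; vertexMinor)

-- (1) In K_{n+1} ⊕₌ K̄_{n+1}, complementing at v₀ makes v₁, ..., v_n independent;
-- v₀ is the centre of the spider with legs v_i - w_i.
spider₁ : ∀ n → Spider (localComp (K (suc n) ⊕₌ Kbar (suc n)) (false , zero)) (false , zero) suc
spider₁ n = record
  { centre-middle = λ j → refl
  ; centre-foot   = λ j → refl
  ; middle-middle = middle-middle
  ; middle-foot   = middle-foot
  ; foot-foot     = foot-foot
  }
  where
  G : Graph (Bool × Fin (suc n))
  G = localComp (K (suc n) ⊕₌ Kbar (suc n)) (false , zero)
  middle-middle : ∀ i j → adj G (false , suc i) (false , suc j) ≡ false
  middle-middle i j with does (i ≟F j)
  ... | true  = refl
  ... | false = refl
  middle-foot : ∀ i j → adj G (false , suc i) (true , suc j) ≡ does (i ≟F j)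
  middle-foot i j with does (i ≟F j)
  ... | true  = refl
  ... | false = refl
  foot-foot : ∀ i j → adj G (true , suc i) (true , suc j) ≡ false
  foot-foot i j with does (i ≟F j)
  ... | true  = refl
  ... | false = refl

-- (2) In K_{n+2} ⊕₌ K_{n+2}, complementing at w₀ and then at v₁ leaves the
-- spider centred at v₁ with legs v_i - w_i for i ≥ 2.
spider₂ : ∀ n → Spider (lcs (K (suc (suc n)) ⊕₌ K (suc (suc n))) ((true , zero) ∷ (false , suc zero) ∷ []))
                       (false , suc zero) (λ i → suc (suc i))
spider₂ n = record
  { centre-middle = λ j → refl
  ; centre-foot   = λ j → refl
  ; middle-middle = middle-middle
  ; middle-foot   = middle-foot
  ; foot-foot     = foot-foot
  }
  where
  G : Graph (Bool × Fin (suc (suc n)))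
  G = lcs (K (suc (suc n)) ⊕₌ K (suc (suc n))) ((true , zero) ∷ (false , suc zero) ∷ [])
  middle-middle : ∀ i j → adj G (false , suc (suc i)) (false , suc (suc j)) ≡ false
  middle-middle i j with does (i ≟F j)
  ... | true  = refl
  ... | false = refl
  middle-foot : ∀ i j → adj G (false , suc (suc i)) (true , suc (suc j)) ≡ does (i ≟F j)
  middle-foot i j with does (i ≟F j)
  ... | true  = refl
  ... | false = refl
  foot-foot : ∀ i j → adj G (true , suc (suc i)) (true , suc (suc j)) ≡ false
  foot-foot i j with does (i ≟F j)
  ... | true  = refl
  ... | false = refl

-- (3) In K_{n+2} ⊕≠ K̄_{n+2}, complementing at v₀ and then at w₁ leaves the
-- spider centred at v₀ with legs v_i - w_i for i ≥ 2.
spider₃ : ∀ n → Spider (lcs (K (suc (suc n)) ⊕≠ Kbar (suc (suc n))) ((false , zero) ∷ (true , suc zero) ∷ []))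
                       (false , zero) (λ i → suc (suc i))
spider₃ n = record
  { centre-middle = λ j → refl
  ; centre-foot   = λ j → refl
  ; middle-middle = middle-middle
  ; middle-foot   = middle-foot
  ; foot-foot     = foot-foot
  }
  where
  G : Graph (Bool × Fin (suc (suc n)))
  G = lcs (K (suc (suc n)) ⊕≠ Kbar (suc (suc n))) ((false , zero) ∷ (true , suc zero) ∷ [])
  middle-middle : ∀ i j → adj G (false , suc (suc i)) (false , suc (suc j)) ≡ false
  middle-middle i j with does (i ≟F j)
  ... | true  = refl
  ... | false = refl
  middle-foot : ∀ i j → adj G (false , suc (suc i)) (true , suc (suc j)) ≡ does (i ≟F j)
  middle-foot i j with does (i ≟F j)
  ... | true  = refl
  ... | false = refl
  foot-foot : ∀ i j → adj G (true , suc (suc i)) (true , suc (suc j)) ≡ false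
  foot-foot i j with does (i ≟F j)
  ... | true  = refl
  ... | false = refl

-- (4) In K_{n+1} ⊕≠ K_{n+1}, complementing at v₀ makes v₁, ..., v_n and
-- w₁, ..., w_n independent and joins v_i to w_j iff i = j, while v₀ sees all
-- of them.  Complementing then at the independent set v₁, ..., v_n removes
-- exactly the edges v₀ w_i, leaving the spider centred at v₀.
module Part₄ (n : ℕ) where
  P : Graph (Bool × Fin (suc n))
  P = K (suc n) ⊕≠ K (suc n)

  G₁ : Graph (Bool × Fin (suc n))
  G₁ = localComp P (false , zero)

  middle : Fin n → Bool × Fin (suc n)
  middle k = (false , suc k)

  foot : Fin n → Bool × Fin (suc n)
  foot k = (true , suc k)

  steps : List (Bool × Fin (suc n))
  steps = (false , zero) ∷ tabulate middle

  G₁-middles : ∀ i j → adj G₁ (middle i) (middle j) ≡ false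
  G₁-middles i j with does (i ≟F j)
  ... | true  = refl
  ... | false = refl

  G₁-matching : ∀ i j → adj G₁ (middle i) (foot j) ≡ does (i ≟F j)
  G₁-matching i j with does (i ≟F j)
  ... | true  = refl
  ... | false = refl

  G₁-feet : ∀ i j → adj G₁ (foot i) (foot j) ≡ false
  G₁-feet i j with does (i ≟F j)
  ... | true  = refl
  ... | false = refl

  G₁-foot-neighbour : ∀ i k → k ≢ i → adj G₁ (middle k) (foot i) ≡ false
  G₁-foot-neighbour i k k≢i = trans (G₁-matching k i) (dec-false (k ≟F i) k≢i)

  no-common-middle : ∀ i z k → adj G₁ (middle k) (middle i) ∧ adj G₁ (middle k) z ≡ false
  no-common-middle i z k rewrite G₁-middles k i = refl

  no-common-foot : ∀ i j → i ≢ j → ∀ k → adj G₁ (middle k) (foot i) ∧ adj G₁ (middle k) (foot j) ≡ false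
  no-common-foot i j i≢j k = by-cases (k ≟F i)
    where
    by-cases : Dec (k ≡ i) → adj G₁ (middle k) (foot i) ∧ adj G₁ (middle k) (foot j) ≡ false
    by-cases (yes refl) rewrite G₁-foot-neighbour j k i≢j = ∧-zeroʳ _
    by-cases (no k≢i)   rewrite G₁-foot-neighbour i k k≢i = refl

  after : ∀ x y → adj (lcs P steps) x y
          ≡ (if does (decGlue x y) then false
             else (adj G₁ x y xor ⨁ (λ k → adj G₁ (middle k) x ∧ adj G₁ (middle k) y)))
  after = GlueLC.localComp-independent G₁ middle G₁-middles

  spider₄ : Spider (lcs P steps) (false , zero) suc
  spider₄ = record
    { centre-middle = λ j → trans (after _ _) (cong (true xor_) (⨁-zero (λ k → G₁-middles k j)))
    ; centre-foot   = centre-foot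
    ; middle-middle = middle-middle
    ; middle-foot   = middle-foot
    ; foot-foot     = foot-foot
    }
    where
    middle-foot : ∀ i j → adj (lcs P steps) (middle i) (foot j) ≡ does (i ≟F j)
    middle-foot i j = trans (after _ _)
      (trans (cong (adj G₁ (middle i) (foot j) xor_) (⨁-zero (no-common-middle i (foot j))))
             (trans (xor-identityʳ _) (G₁-matching i j)))

    centre-foot : ∀ j → adj (lcs P steps) (false , zero) (foot j) ≡ false
    -- the middle j is the only common neighbour of v₀ and foot j
    centre-foot j = trans (after _ _) (cong (true xor_)
      (trans (⨁-single j (G₁-foot-neighbour j))
             (trans (G₁-matching j j) (dec-true (j ≟F j) refl))))

    middle-middle : ∀ i j → adj (lcs P steps) (middle i) (middle j) ≡ false
    middle-middle i j rewrite after (middle i) (middle j) | G₁-middles i j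
                            | ⨁-zero (no-common-middle i (middle j)) =
      guard-false (does (decGlue (middle i) (middle j)))

    foot-foot : ∀ i j → adj (lcs P steps) (foot i) (foot j) ≡ false
    foot-foot i j rewrite after (foot i) (foot j) = by-cases (decGlue (foot i) (foot j))
      where
      by-cases : (d : Dec (foot i ≡ foot j)) → (if does d then false
                 else (adj G₁ (foot i) (foot j) xor ⨁ (λ k → adj G₁ (middle k) (foot i) ∧ adj G₁ (middle k) (foot j)))) ≡ false
      by-cases (yes _)  = refl
      by-cases (no i≢j) rewrite G₁-feet i j =
        ⨁-zero (no-common-foot i j (λ i≡j → i≢j (cong foot i≡j)))

copies-↪ : ∀ {V W} n {G : Graph V} {H : Graph W} → H ↪ G → copies n H ↪ copies n G
copies-↪ {V} {W} n {G} {H} (f , f-inj , f-adj) = g , g-inj , g-adj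
  where
  g : Fin n × W → Fin n × V
  g (k , x) = (k , f x)
  g-inj : Injective _≡_ _≡_ g
  g-inj e = cong₂ _,_ (,-injectiveˡ e) (f-inj (,-injectiveʳ e))
  g-adj : ∀ x y → adj (copies n H) x y ≡ adj (copies n G) (g x) (g y)
  g-adj (k , x) (l , y) = cong (does (k ≟F l) ∧_) (f-adj x y)

module Copies {W : Set} (_≟W_ : DecidableEquality W) (n : ℕ) where
  _≟C_ : DecidableEquality (Fin n × W)
  _≟C_ = ≡-dec _≟F_ _≟W_

  module LW = LocalComplementation _≟W_
  module LC = LocalComplementation _≟C_

  copiesOf : W → List (Fin n × W)
  copiesOf u = tabulate (λ k → (k , u))

  -- Complementing nG at all copies of u complements each copy of G at u:
  -- the copies of u are independent, and the only copy of u adjacent to both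
  -- (k , x) and (k , y) is (k , u).
  copies-localComp : ∀ G u → LC.lcs (copies n G) (copiesOf u) ≐ copies n (LW.localComp G u)
  copies-localComp G u (k , x) (l , y) =
    trans (LC.localComp-independent {n} (copies n G) (λ j → (j , u)) independent (k , x) (l , y))
          (by-cases (k ≟F l))
    where
    independent : ∀ a b → adj (copies n G) (a , u) (b , u) ≡ false
    independent a b rewrite adj-irr G u = ∧-zeroʳ (does (a ≟F b))
    Gᶜ : Graph (Fin n × W)
    Gᶜ = copies n G
    parity : Bool
    parity = ⨁ (λ j → adj Gᶜ (j , u) (k , x) ∧ adj Gᶜ (j , u) (l , y))

    by-cases : Dec (k ≡ l) →
      (if does ((k , x) ≟C (l , y)) then false else (adj Gᶜ (k , x) (l , y) xor parity))
      ≡ adj (copies n (LW.localComp G u)) (k , x) (l , y)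
    by-cases (yes refl) = begin
        (if does ((k , x) ≟C (k , y)) then false else ((does (k ≟F k) ∧ adj G x y) xor parity))
      ≡⟨ cong₂ (λ d t → if d then false else ((t ∧ adj G x y) xor parity)) same-copy k≡k ⟩
        (if does (x ≟W y) then false else (adj G x y xor parity))
      ≡⟨ cong (λ t → if does (x ≟W y) then false else (adj G x y xor t)) parity-u ⟩
        LW.lcAdj G u x y
      ≡⟨ cong (_∧ LW.lcAdj G u x y) (sym k≡k) ⟩
        does (k ≟F k) ∧ LW.lcAdj G u x y
      ∎
      where
      open ≡-Reasoning
      k≡k : does (k ≟F k) ≡ true
      k≡k = dec-true (k ≟F k) refl
      same-copy : does ((k , x) ≟C (k , y)) ≡ does (x ≟W y)
      same-copy = does-⇔ (mk⇔ (cong proj₂) (cong (k ,_))) ((k , x) ≟C (k , y)) (x ≟W y)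
      parity-u : parity ≡ adj G u x ∧ adj G u y
      parity-u = trans (⨁-single k (λ j j≢k → cong (λ d → (d ∧ adj G u x) ∧ (d ∧ adj G u y))
                                                    (dec-false (j ≟F k) j≢k)))
                       (cong (λ d → (d ∧ adj G u x) ∧ (d ∧ adj G u y)) k≡k)
    by-cases (no k≢l) = begin
        (if does ((k , x) ≟C (l , y)) then false else ((does (k ≟F l) ∧ adj G x y) xor parity))
      ≡⟨ cong₂ (λ d t → if does ((k , x) ≟C (l , y)) then false else ((d ∧ adj G x y) xor t))
               k≢l-false (⨁-zero no-common) ⟩
        (if does ((k , x) ≟C (l , y)) then false else false)
      ≡⟨ guard-false (does ((k , x) ≟C (l , y))) ⟩
        false
      ≡⟨ cong (_∧ LW.lcAdj G u x y) (sym k≢l-false) ⟩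
        does (k ≟F l) ∧ LW.lcAdj G u x y
      ∎
      where
      open ≡-Reasoning
      k≢l-false : does (k ≟F l) ≡ false
      k≢l-false = dec-false (k ≟F l) k≢l
      no-common : ∀ j → adj Gᶜ (j , u) (k , x) ∧ adj Gᶜ (j , u) (l , y) ≡ false
      no-common j = in-copy (j ≟F k)
        where
        in-copy : Dec (j ≡ k) → adj Gᶜ (j , u) (k , x) ∧ adj Gᶜ (j , u) (l , y) ≡ false
        in-copy (yes refl) rewrite dec-false (j ≟F l) k≢l = ∧-zeroʳ _
        in-copy (no j≢k)   rewrite dec-false (j ≟F k) j≢k = refl

  copies-lcs : ∀ G l → LC.lcs (copies n G) (concatMap copiesOf l) ≐ copies n (LW.lcs G l)
  copies-lcs G []      x y = refl
  copies-lcs G (u ∷ l) x y = begin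
      adj (LC.lcs (copies n G) (copiesOf u ++ concatMap copiesOf l)) x y
    ≡⟨ cong (λ R → adj R x y) (LC.lcs-++ (copies n G) (copiesOf u) (concatMap copiesOf l)) ⟩
      adj (LC.lcs (LC.lcs (copies n G) (copiesOf u)) (concatMap copiesOf l)) x y
    ≡⟨ LC.lcs-resp (copies-localComp G u) (concatMap copiesOf l) x y ⟩
      adj (LC.lcs (copies n (LW.localComp G u)) (concatMap copiesOf l)) x y
    ≡⟨ copies-lcs (LW.localComp G u) l x y ⟩
      adj (copies n (LW.lcs G (u ∷ l))) x y
    ∎
    where open ≡-Reasoning

  copies-vertexMinor : ∀ {V} {G : Graph W} {R : Graph (Fin n × W)} {H : Graph V} (l : List W) →
                       R ≐ copies n G → H ↪ LW.lcs G l → HasVertexMinor _≟C_ R (copies n H)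
  copies-vertexMinor {G = G} {R} {H} l R≐nG H↪ = LC.vertexMinor {H = copies n H} steps nH↪
    where
    steps : List (Fin n × W)
    steps = concatMap copiesOf l
    nG*≐R* : copies n (LW.lcs G l) ≐ LC.lcs R steps
    nG*≐R* x y = sym (trans (LC.lcs-resp R≐nG steps x y) (copies-lcs G l x y))
    -- the graphs are passed explicitly, as adjacency equations do not determine them
    nH↪ : copies n H ↪ LC.lcs R steps
    nH↪ = ↪-resp {H = copies n H} {G = copies n (LW.lcs G l)} {G' = LC.lcs R steps}
                 (copies-↪ n {LW.lcs G l} {H} H↪) nG*≐R*

pow-zero≐copies : ∀ {m} n (P : Graph (Bool × Fin m)) → pow n zeroMat P ≐ copies n P
pow-zero≐copies n P (k , x) (l , y) with <-cmp k l
... | tri< _ k≢l _ = sym (cong (_∧ adj P x y) (dec-false (k ≟F l) k≢l))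
... | tri≈ _ refl _ = sym (cong (_∧ adj P x y) (dec-true (k ≟F k) refl))
... | tri> _ k≢l _ = sym (cong (_∧ adj P x y) (dec-false (k ≟F l) k≢l))

ReachesT2 : ∀ {m} → ℕ → Graph (Bool × Fin m) → Set
ReachesT2 {m} n P = Σ (List (Bool × Fin m)) λ l → T2 n ↪ lcs P l

reachesT2₁ : ∀ n → ReachesT2 n (K (suc n) ⊕₌ Kbar (suc n))
reachesT2₁ n = (false , zero) ∷ [] , spider-↪ suc-injective (λ i ()) (spider₁ n)

reachesT2₂ : ∀ n → ReachesT2 n (K (suc (suc n)) ⊕₌ K (suc (suc n)))
reachesT2₂ n = (true , zero) ∷ (false , suc zero) ∷ [] ,
               spider-↪ (λ e → suc-injective (suc-injective e)) (λ i ()) (spider₂ n)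

reachesT2₃ : ∀ n → ReachesT2 n (K (suc (suc n)) ⊕≠ Kbar (suc (suc n)))
reachesT2₃ n = (false , zero) ∷ (true , suc zero) ∷ [] ,
               spider-↪ (λ e → suc-injective (suc-injective e)) (λ i ()) (spider₃ n)

reachesT2₄ : ∀ n → ReachesT2 n (K (suc n) ⊕≠ K (suc n))
reachesT2₄ n = Part₄.steps n , spider-↪ suc-injective (λ i ()) (Part₄.spider₄ n)

T2-minor : ∀ {m n} {P : Graph (Bool × Fin m)} → ReachesT2 n P → HasVertexMinor decGlue P (T2 n)
T2-minor {n = n} {P} (l , T2↪) = vertexMinor {G = P} {H = T2 n} l T2↪

nT2-minor : ∀ {m n} {P : Graph (Bool × Fin m)} → ReachesT2 n P →
            HasVertexMinor decPow (pow n zeroMat P) (copies n (T2 n))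
nT2-minor {n = n} {P} (l , T2↪) =
  Copies.copies-vertexMinor decGlue n {G = P} {H = T2 n} l (pow-zero≐copies n P) T2↪

-- Lemma 4.10; the argument works for every n, so the hypothesis 1 ≤ n is unused.
lemma4p10 : (n : ℕ) → 1 ≤ n →
    (HasVertexMinor decGlue (K (suc n) ⊕₌ Kbar (suc n)) (T2 n)
     × HasVertexMinor decGlue (K (suc (suc n)) ⊕₌ K (suc (suc n))) (T2 n)
     × HasVertexMinor decGlue (K (suc (suc n)) ⊕≠ Kbar (suc (suc n))) (T2 n)
     × HasVertexMinor decGlue (K (suc n) ⊕≠ K (suc n)) (T2 n))
    × (HasVertexMinor decPow (pow n zeroMat (K (suc n) ⊕₌ Kbar (suc n))) (copies n (T2 n))
     × HasVertexMinor decPow (pow n zeroMat (K (suc (suc n)) ⊕₌ K (suc (suc n)))) (copies n (T2 n))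
     × HasVertexMinor decPow (pow n zeroMat (K (suc (suc n)) ⊕≠ Kbar (suc (suc n)))) (copies n (T2 n))
     × HasVertexMinor decPow (pow n zeroMat (K (suc n) ⊕≠ K (suc n))) (copies n (T2 n)))
lemma4p10 n _ =
  (T2-minor (reachesT2₁ n) , T2-minor (reachesT2₂ n) , T2-minor (reachesT2₃ n) , T2-minor (reachesT2₄ n)) ,
  (nT2-minor (reachesT2₁ n) , nT2-minor (reachesT2₂ n) , nT2-minor (reachesT2₃ n) , nT2-minor (reachesT2₄ n))
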